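{- Let $F(X,Y)$ be a Boolean formula over input variables $X=\{x_1,\dots,x_n\}$ and output variables $Y=\{y_1,\dots,y_m\}$. For $\sigma\in 2^X$ let $\mathsf{Sol}(F\wedge(X=\sigma))$ denote the set of models of $F$ in which $X$ is assigned $\sigma$, and let $S_2=\{\sigma\in 2^X : |\mathsf{Sol}(F\wedge(X=\sigma))|\ge 2\}$. Then $$\log|\mathsf{Skolem}(F,Y)| \;=\; \sum_{\sigma\in S_2}\log|\mathsf{Sol}(F\wedge(X=\sigma))| .$$
   Context: A Skolem function vector for $F(X,Y)$ is a vector $\Psi(X)=\langle \psi_1(X),\dots,\psi_m(X)\rangle$ of Boolean functions of $X$ such that $\exists Y\,F(X,Y)\equiv F(X,\Psi(X))$. $\mathsf{Skolem}(F,Y)$ denotes the set of such vectors, where functions are identified by their input–output behaviour, and two vectors $\Psi_1,\Psi_2$ are counted as different if and only if there is an assignment $\sigma\in 2^X$ such that $F(\sigma,\pi)=1$ for some $\pi\in 2^Y$ and $\Psi_1(\sigma)\neq\Psi_2(\sigma)$. A model of a formula is a satisfying assignment to all its variables. -}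

module Defs where

open import Level using (0ℓ)
open import Data.Bool using (Bool; true; false; not; _∧_; _∨_)
open import Data.Nat using (ℕ; zero; suc; _≤?_)
open import Data.Fin using (Fin)
open import Data.Vec using (Vec; []; _∷_; lookup)
open import Data.List using (List; []; _∷_; map; _++_; filter; length)
open import Data.Nat.ListAction using (product)
open import Data.Product using (Σ; ∃; _,_; proj₁)
open import Function.Bundles using (_⇔_; Inverse)
open import Relation.Binary.Bundles using (Setoid)
open import Relation.Binary.PropositionalEquality as ≡ using (_≡_)
open import Data.Bool.Properties using (T?)
open import Relation.Nullary using (Dec)

data Formula (n m : ℕ) : Set where
  xvar : Fin n → Formula n m
  yvar : Fin m → Formula n m
  const : Bool → Formula n m
  neg  : Formula n m → Formula n m
  and  : Formula n m → Formula n m → Formula n m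
  or   : Formula n m → Formula n m → Formula n m

eval : ∀ {n m} → Formula n m → Vec Bool n → Vec Bool m → Bool
eval (xvar i) σ π = lookup σ i
eval (yvar j) σ π = lookup π j
eval (const b) σ π = b
eval (neg f) σ π = not (eval f σ π)
eval (and f g) σ π = eval f σ π ∧ eval g σ π
eval (or f g) σ π = eval f σ π ∨ eval g σ π

allVecs : (k : ℕ) → List (Vec Bool k)
allVecs zero = [] ∷ []
allVecs (suc k) = map (false ∷_) (allVecs k) ++ map (true ∷_) (allVecs k)

-- |Sol(F ∧ (X = σ))|: models of F with X assigned σ correspond exactly to
-- the π ∈ 2^Y with F(σ,π) = 1.
solCount : ∀ {n m} → Formula n m → Vec Bool n → ℕ
solCount {m = m} F σ = length (filter (λ π → T? (eval F σ π)) (allVecs m))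

IsSkolem : ∀ {n m} → Formula n m → (Vec Bool n → Vec Bool m) → Set
IsSkolem F Ψ = ∀ σ → (∃ λ π → eval F σ π ≡ true) ⇔ (eval F σ (Ψ σ) ≡ true)

SkolemEq : ∀ {n m} → Formula n m → (Ψ₁ Ψ₂ : Vec Bool n → Vec Bool m) → Set
SkolemEq F Ψ₁ Ψ₂ = ∀ σ → (∃ λ π → eval F σ π ≡ true) → Ψ₁ σ ≡ Ψ₂ σ

SkolemSetoid : ∀ {n m} → Formula n m → Setoid 0ℓ 0ℓ
SkolemSetoid {n} {m} F = record
  { Carrier = Σ (Vec Bool n → Vec Bool m) (IsSkolem F)
  ; _≈_ = λ a b → SkolemEq F (proj₁ a) (proj₁ b)
  ; isEquivalence = record
    { refl = λ σ _ → ≡.refl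
    ; sym = λ p σ e → ≡.sym (p σ e)
    ; trans = λ p q σ e → ≡.trans (p σ e) (q σ e)
    }
  }

HasCard : Setoid 0ℓ 0ℓ → ℕ → Set
HasCard S k = Inverse S (≡.setoid (Fin k))

S₂ : ∀ {n m} → Formula n m → List (Vec Bool n)
S₂ {n} F = filter (λ σ → 2 ≤? solCount F σ) (allVecs n)

prodS₂ : ∀ {n m} → Formula n m → ℕ
prodS₂ F = product (map (solCount F) (S₂ F))

{-# OPTIONS --safe #-}
-- A Skolem vector may be chosen independently at every σ ∈ 2^X.  Where F(σ,·)
-- is unsatisfiable its value is irrelevant (all choices are identified), so σ
-- contributes one class; otherwise Ψ(σ) must be one of the |Sol(F ∧ (X = σ))|
-- solutions.  Hence |Skolem(F,Y)| = ∏_σ max(1, |Sol(F ∧ (X = σ))|), and the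
-- factors equal to 1 are exactly those with σ ∉ S₂.
module Submission where

open import Defs
open import Level using (0ℓ)
open import Data.Nat using (ℕ; zero; suc; _+_; _*_; _⊔_; _≤?_)
open import Data.Nat.Properties using (*-identityʳ; *-identityˡ; <⇒≤; ≮⇒≥; m≤n⇒m⊔n≡n; m≥n⇒m⊔n≡m)
open import Data.Bool using (Bool; true; false; if_then_else_)
open import Data.Bool.Properties using (T?)
open import Data.Fin using (Fin; zero; splitAt; join; combine; remQuot)
open import Data.Fin.Properties using (splitAt-join; join-splitAt; remQuot-combine; combine-remQuot)
open import Data.Vec using (Vec; []; _∷_; replicate)
open import Data.List using (List; []; _∷_; map; _++_; filter; length)
open import Data.List.Properties using (length-map; length-++; map-∘; map-++; filter-++; filter-accept; filter-reject)
open import Data.Nat.ListAction using (product)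
open import Data.Nat.ListAction.Properties using (product-++)
open import Data.Product using (Σ; _,_; proj₁; proj₂; _×_; uncurry)
open import Data.Product.Relation.Binary.Pointwise.NonDependent using () renaming (Pointwise to _×ᵣ_)
open import Data.Sum using (_⊎_; inj₁; inj₂)
import Data.Sum as Sum
open import Data.Sum.Relation.Binary.Pointwise using (Pointwise; inj₁; inj₂)
open import Function using (id; _∘_; _on_; case_of_; _⇔_; Inverse; mk⇔; Equivalence)
open import Relation.Binary using (Rel; Setoid)
open import Relation.Nullary using (yes; no; ¬_)
open import Data.Empty using (⊥-elim)
open import Relation.Unary using (Decidable)
open import Relation.Binary.PropositionalEquality as ≡
  using (_≡_; refl; sym; trans; cong; cong₂; subst; module ≡-Reasoning)
open ≡-Reasoning

private
  variable
    A B : Set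
    k : ℕ

-- An Inverse onto Fin k, for a relation _≈_ that need not be an equivalence.
record Enumeration (A : Set) (_≈_ : Rel A 0ℓ) (k : ℕ) : Set where
  field
    to        : Fin k → A
    from      : A → Fin k
    from-cong : ∀ {x y} → x ≈ y → from x ≡ from y
    to-from   : ∀ x → to (from x) ≈ x
    from-to   : ∀ i → from (to i) ≡ i
open Enumeration

enumeration⇒inverse : (S : Setoid 0ℓ 0ℓ) → Enumeration (Setoid.Carrier S) (Setoid._≈_ S) k →
                      Inverse S (≡.setoid (Fin k))
enumeration⇒inverse S E = record
  { to        = from E
  ; from      = to E
  ; to-cong   = from-cong E
  ; from-cong = λ { refl → Setoid.refl S }
  ; inverse   = (λ {i} y≈to-i → trans (from-cong E y≈to-i) (from-to E i))
              , (λ { {x} refl → to-from E x })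
  }

transport : {_≈ᴬ_ : Rel A 0ℓ} {_≈ᴮ_ : Rel B 0ℓ} (f : B → A) (g : A → B) →
            (∀ {x y} → x ≈ᴮ y → f x ≈ᴬ f y) →
            (∀ {x y} → x ≈ᴬ f y → g x ≈ᴮ y) →
            (∀ x → f (g x) ≡ x) →
            Enumeration A _≈ᴬ_ k → Enumeration B _≈ᴮ_ k
transport f g f-cong g-inverse f∘g E = record
  { to        = g ∘ to E
  ; from      = from E ∘ f
  ; from-cong = from-cong E ∘ f-cong
  ; to-from   = λ x → g-inverse (to-from E (f x))
  ; from-to   = λ i → trans (cong (from E) (f∘g (to E i))) (from-to E i)
  }

empty-enumeration : {_≈_ : Rel A 0ℓ} → ¬ A → Enumeration A _≈_ 0
empty-enumeration ¬A = record
  { to        = λ ()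
  ; from      = ⊥-elim ∘ ¬A
  ; from-cong = λ {x} _ → ⊥-elim (¬A x)
  ; to-from   = ⊥-elim ∘ ¬A
  ; from-to   = λ ()
  }

singleton-enumeration : {_≈_ : Rel A 0ℓ} (x : A) → (∀ y → x ≈ y) → Enumeration A _≈_ 1
singleton-enumeration x x≈ = record
  { to        = λ _ → x
  ; from      = λ _ → zero
  ; from-cong = λ _ → refl
  ; to-from   = x≈
  ; from-to   = λ { zero → refl }
  }

_⊎-enumeration_ : ∀ {A B : Set} {a b} {_≈ᴬ_ : Rel A 0ℓ} {_≈ᴮ_ : Rel B 0ℓ} →
                  Enumeration A _≈ᴬ_ a → Enumeration B _≈ᴮ_ b →
                  Enumeration (A ⊎ B) (Pointwise _≈ᴬ_ _≈ᴮ_) (a + b)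
_⊎-enumeration_ {A} {B} {a} {b} {_≈ᴬ_} {_≈ᴮ_} EA EB = record
  { to        = to⊎ ∘ splitAt a
  ; from      = join a b ∘ from⊎
  ; from-cong = λ { (inj₁ x≈y) → cong (join a b ∘ inj₁) (from-cong EA x≈y)
                  ; (inj₂ x≈y) → cong (join a b ∘ inj₂) (from-cong EB x≈y) }
  ; to-from   = to-from⊎
  ; from-to   = λ i → trans (cong (join a b) (from⊎-to⊎ (splitAt a i))) (join-splitAt a b i)
  }
  where
  to⊎ : Fin a ⊎ Fin b → A ⊎ B
  to⊎ = Sum.map (to EA) (to EB)

  from⊎ : A ⊎ B → Fin a ⊎ Fin b
  from⊎ = Sum.map (from EA) (from EB)

  from⊎-to⊎ : ∀ s → from⊎ (to⊎ s) ≡ s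
  from⊎-to⊎ (inj₁ i) = cong inj₁ (from-to EA i)
  from⊎-to⊎ (inj₂ j) = cong inj₂ (from-to EB j)

  to-from⊎ : ∀ s → Pointwise _≈ᴬ_ _≈ᴮ_ (to⊎ (splitAt a (join a b (from⊎ s)))) s
  to-from⊎ s rewrite splitAt-join a b (from⊎ s) with s
  ... | inj₁ x = inj₁ (to-from EA x)
  ... | inj₂ y = inj₂ (to-from EB y)

_×-enumeration_ : ∀ {A B : Set} {a b} {_≈ᴬ_ : Rel A 0ℓ} {_≈ᴮ_ : Rel B 0ℓ} →
                  Enumeration A _≈ᴬ_ a → Enumeration B _≈ᴮ_ b →
                  Enumeration (A × B) (_≈ᴬ_ ×ᵣ _≈ᴮ_) (a * b)
_×-enumeration_ {A} {B} {a} {b} {_≈ᴬ_} {_≈ᴮ_} EA EB = record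
  { to        = to× ∘ remQuot b
  ; from      = λ (x , y) → combine (from EA x) (from EB y)
  ; from-cong = λ (x≈x′ , y≈y′) → cong₂ combine (from-cong EA x≈x′) (from-cong EB y≈y′)
  ; to-from   = to-from×
  ; from-to   = λ i → trans (cong₂ combine (from-to EA _) (from-to EB _)) (combine-remQuot {a} b i)
  }
  where
  to× : Fin a × Fin b → A × B
  to× (i , j) = to EA i , to EB j

  to-from× : ∀ p → (_≈ᴬ_ ×ᵣ _≈ᴮ_) (to× (remQuot b (combine (from EA (proj₁ p)) (from EB (proj₂ p))))) p
  to-from× (x , y) = subst (λ ij → (_≈ᴬ_ ×ᵣ _≈ᴮ_) (to× ij) (x , y))
                           (sym (remQuot-combine (from EA x) (from EB y)))
                           (to-from EA x , to-from EB y)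

count : ∀ {m} → (Vec Bool m → Bool) → ℕ
count {zero}  p = if p [] then 1 else 0
count {suc m} p = count (p ∘ (false ∷_)) + count (p ∘ (true ∷_))

∏ : ∀ {n} → (Vec Bool n → ℕ) → ℕ
∏ {zero}  g = g []
∏ {suc n} g = ∏ (g ∘ (false ∷_)) * ∏ (g ∘ (true ∷_))

filter-map : ∀ {P : B → Set} (P? : Decidable P) (f : A → B) xs →
             filter P? (map f xs) ≡ map f (filter (P? ∘ f) xs)
filter-map P? f [] = refl
filter-map P? f (x ∷ xs) with P? (f x)
... | yes _ = cong (f x ∷_) (filter-map P? f xs)
... | no  _ = filter-map P? f xs

length-filter-allVecs : ∀ m (p : Vec Bool m → Bool) →
                        length (filter (T? ∘ p) (allVecs m)) ≡ count p
length-filter-allVecs zero p with p []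
... | true  = refl
... | false = refl
length-filter-allVecs (suc m) p = begin
  length (filter (T? ∘ p) (map (false ∷_) vs ++ map (true ∷_) vs))
    ≡⟨ cong length (filter-++ (T? ∘ p) (map (false ∷_) vs) _) ⟩
  length (filter (T? ∘ p) (map (false ∷_) vs) ++ filter (T? ∘ p) (map (true ∷_) vs))
    ≡⟨ length-++ (filter (T? ∘ p) (map (false ∷_) vs)) ⟩
  length (filter (T? ∘ p) (map (false ∷_) vs)) + length (filter (T? ∘ p) (map (true ∷_) vs))
    ≡⟨ cong₂ _+_ (half false) (half true) ⟩
  count p ∎
  where
  vs = allVecs m
  half : ∀ x → length (filter (T? ∘ p) (map (x ∷_) vs)) ≡ count (p ∘ (x ∷_))
  half x = begin
    length (filter (T? ∘ p) (map (x ∷_) vs))       ≡⟨ cong length (filter-map (T? ∘ p) (x ∷_) vs) ⟩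
    length (map (x ∷_) (filter (T? ∘ p ∘ (x ∷_)) vs)) ≡⟨ length-map (x ∷_) (filter (T? ∘ p ∘ (x ∷_)) vs) ⟩
    length (filter (T? ∘ p ∘ (x ∷_)) vs)             ≡⟨ length-filter-allVecs m (p ∘ (x ∷_)) ⟩
    count (p ∘ (x ∷_))                               ∎

product-map-allVecs : ∀ n (g : Vec Bool n → ℕ) → product (map g (allVecs n)) ≡ ∏ g
product-map-allVecs zero    g = *-identityʳ (g [])
product-map-allVecs (suc n) g = begin
  product (map g (map (false ∷_) vs ++ map (true ∷_) vs))
    ≡⟨ cong product (map-++ g (map (false ∷_) vs) _) ⟩
  product (map g (map (false ∷_) vs) ++ map g (map (true ∷_) vs))
    ≡⟨ product-++ (map g (map (false ∷_) vs)) _ ⟩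
  product (map g (map (false ∷_) vs)) * product (map g (map (true ∷_) vs))
    ≡⟨ cong₂ _*_ (half false) (half true) ⟩
  ∏ g ∎
  where
  vs = allVecs n
  half : ∀ x → product (map g (map (x ∷_) vs)) ≡ ∏ (g ∘ (x ∷_))
  half x = trans (cong product (sym (map-∘ vs))) (product-map-allVecs n (g ∘ (x ∷_)))

product-filter-2≤ : (f : A → ℕ) (xs : List A) →
                    product (map f (filter (λ x → 2 ≤? f x) xs)) ≡ product (map (λ x → 1 ⊔ f x) xs)
product-filter-2≤ f [] = refl
product-filter-2≤ f (x ∷ xs) with 2 ≤? f x
... | yes 2≤fx = begin
  product (map f (filter 2≤? (x ∷ xs)))          ≡⟨ cong (product ∘ map f) (filter-accept 2≤? 2≤fx) ⟩
  f x * product (map f (filter 2≤? xs))          ≡⟨ cong₂ _*_ (sym (m≤n⇒m⊔n≡n {1} (<⇒≤ 2≤fx))) (product-filter-2≤ f xs) ⟩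
  (1 ⊔ f x) * product (map (λ x → 1 ⊔ f x) xs)  ∎
  where 2≤? = λ x → 2 ≤? f x
... | no  2≰fx = begin
  product (map f (filter 2≤? (x ∷ xs)))          ≡⟨ cong (product ∘ map f) (filter-reject 2≤? 2≰fx) ⟩
  product (map f (filter 2≤? xs))                ≡⟨ product-filter-2≤ f xs ⟩
  product (map (λ x → 1 ⊔ f x) xs)              ≡⟨ *-identityˡ _ ⟨
  1 * product (map (λ x → 1 ⊔ f x) xs)          ≡⟨ cong (_* _) (m≥n⇒m⊔n≡m {1} (≮⇒≥ 2≰fx)) ⟨
  (1 ⊔ f x) * product (map (λ x → 1 ⊔ f x) xs)  ∎
  where 2≤? = λ x → 2 ≤? f x

Solution : ∀ {m} → (Vec Bool m → Bool) → Set
Solution {m} p = Σ (Vec Bool m) (λ π → p π ≡ true)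

enumerate-solutions : ∀ m (p : Vec Bool m → Bool) → Enumeration (Solution p) (_≡_ on proj₁) (count p)
enumerate-solutions zero p with p [] in eq
... | true  = singleton-enumeration ([] , eq) (λ { ([] , _) → refl })
... | false = empty-enumeration λ { ([] , e) → case trans (sym eq) e of λ () }
enumerate-solutions (suc m) p =
  transport split unsplit split-cong unsplit-inverse (λ { (inj₁ _) → refl ; (inj₂ _) → refl })
            (enumerate-solutions m p₀ ⊎-enumeration enumerate-solutions m p₁)
  where
  p₀ p₁ : Vec Bool m → Bool
  p₀ = p ∘ (false ∷_)
  p₁ = p ∘ (true ∷_)

  split : Solution p → Solution p₀ ⊎ Solution p₁
  split (false ∷ π , e) = inj₁ (π , e)
  split (true  ∷ π , e) = inj₂ (π , e)

  unsplit : Solution p₀ ⊎ Solution p₁ → Solution p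
  unsplit (inj₁ (π , e)) = false ∷ π , e
  unsplit (inj₂ (π , e)) = true ∷ π , e

  split-cong : ∀ {x y} → proj₁ x ≡ proj₁ y → Pointwise (_≡_ on proj₁) (_≡_ on proj₁) (split x) (split y)
  split-cong {false ∷ _ , _} {false ∷ _ , _} refl = inj₁ refl
  split-cong {true  ∷ _ , _} {true  ∷ _ , _} refl = inj₂ refl

  unsplit-inverse : ∀ {x y} → Pointwise (_≡_ on proj₁) (_≡_ on proj₁) x (split y) →
                    proj₁ (unsplit x) ≡ proj₁ y
  unsplit-inverse {y = false ∷ _ , _} (inj₁ π≡π′) = cong (false ∷_) π≡π′
  unsplit-inverse {y = true  ∷ _ , _} (inj₂ π≡π′) = cong (true ∷_) π≡π′

Choice : ∀ {m} → (Vec Bool m → Bool) → Set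
Choice {m} p = Σ (Vec Bool m) (λ v → Solution p ⇔ (p v ≡ true))

_≈ᶜ_ : ∀ {m} {p : Vec Bool m → Bool} → Rel (Choice p) 0ℓ
_≈ᶜ_ {p = p} x y = Solution p → proj₁ x ≡ proj₁ y

enumerate-choices : ∀ {m k} {p : Vec Bool m → Bool} →
                    Enumeration (Solution p) (_≡_ on proj₁) k → Enumeration (Choice p) _≈ᶜ_ (1 ⊔ k)
enumerate-choices {m} {zero} E =
  singleton-enumeration (replicate m false , mk⇔ (⊥-elim ∘ unsolvable) (⊥-elim ∘ unsolvable ∘ (_ ,_)))
                        (λ _ → ⊥-elim ∘ unsolvable)
  where
  unsolvable : ¬ Solution _
  unsolvable s with () ← from E s
enumerate-choices {k = suc k} {p = p} E =
  transport solution choice (λ x≈y → x≈y (to E zero)) (λ x≡y _ → x≡y) (λ _ → refl) E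
  where
  solution : Choice p → Solution p
  solution (v , v-admissible) = v , Equivalence.to v-admissible (to E zero)

  choice : Solution p → Choice p
  choice (π , e) = π , mk⇔ (λ _ → e) (λ _ → π , e)

caseHead : ∀ {n} {A : Vec Bool (suc n) → Set} →
           (∀ σ → A (false ∷ σ)) → (∀ σ → A (true ∷ σ)) → ∀ σ → A σ
caseHead h₀ h₁ (false ∷ σ) = h₀ σ
caseHead h₀ h₁ (true  ∷ σ) = h₁ σ

enumerate-Π : ∀ n {A : Vec Bool n → Set} {R : ∀ σ → Rel (A σ) 0ℓ} {g : Vec Bool n → ℕ} →
              (∀ σ → Enumeration (A σ) (R σ) (g σ)) →
              Enumeration (∀ σ → A σ) (λ h h′ → ∀ σ → R σ (h σ) (h′ σ)) (∏ g)
enumerate-Π zero E =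
  transport (λ h → h []) (λ x → λ { [] → x }) (λ h≈h′ → h≈h′ []) (λ { x≈h [] → x≈h }) (λ _ → refl) (E [])
enumerate-Π (suc n) {A} E =
  transport (λ h → h ∘ (false ∷_) , h ∘ (true ∷_)) (uncurry (caseHead {A = A}))
            (λ h≈h′ → h≈h′ ∘ (false ∷_) , h≈h′ ∘ (true ∷_))
            (λ { (h₀≈ , h₁≈) (false ∷ σ) → h₀≈ σ ; (h₀≈ , h₁≈) (true ∷ σ) → h₁≈ σ })
            (λ _ → refl)
            (enumerate-Π n (E ∘ (false ∷_)) ×-enumeration enumerate-Π n (E ∘ (true ∷_)))

proposition1 : ∀ (n m : ℕ) (F : Formula n m) →
    HasCard (SkolemSetoid F) (prodS₂ F)
proposition1 n m F =
  enumeration⇒inverse (SkolemSetoid F) (subst (Enumeration _ _) ∏≡prodS₂ skolem-vectors)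
  where
  solutions : ∀ σ → Enumeration (Solution (eval F σ)) (_≡_ on proj₁) (solCount F σ)
  solutions σ = subst (Enumeration _ _) (sym (length-filter-allVecs m (eval F σ)))
                      (enumerate-solutions m (eval F σ))

  skolem-vectors : Enumeration (Setoid.Carrier (SkolemSetoid F)) (Setoid._≈_ (SkolemSetoid F))
                               (∏ (λ σ → 1 ⊔ solCount F σ))
  -- SkolemEq F is, definitionally, the pointwise extension of _≈ᶜ_.
  skolem-vectors = transport (λ (Ψ , Ψ-skolem) σ → Ψ σ , Ψ-skolem σ) (λ h → proj₁ ∘ h , proj₂ ∘ h)
                             id id (λ _ → refl)
                             (enumerate-Π n (enumerate-choices ∘ solutions))

  ∏≡prodS₂ : ∏ (λ σ → 1 ⊔ solCount F σ) ≡ prodS₂ F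
  ∏≡prodS₂ = sym (trans (product-filter-2≤ (solCount F) (allVecs n))
                        (product-map-allVecs n (λ σ → 1 ⊔ solCount F σ)))
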